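{- For every finite simple graph $G$, the edge-biclique hypergraph $\mathcal{EB}(G)$ is equal to the clique hypergraph $\mathcal{K}(L_G)$ of the biclique line graph $L_G$ if and only if $G$ contains no induced subgraph isomorphic to the triangular prism.
   Context: Graphs are finite and simple. A biclique of $G$ is a vertex set $B\subseteq V(G)$ such that $G[B]$ is a complete bipartite graph and $B$ is inclusion-wise maximal with this property. A clique of a graph is an inclusion-wise maximal vertex set inducing a complete graph. The edge-biclique hypergraph $\mathcal{EB}(G)$ has vertex set $E(G)$ and its hyperedges are the edge sets $E(G[B])$ of the bicliques $B$ of $G$. The biclique line graph $L_G$ is the graph with vertex set $E(G)$ in which two edges of $G$ are adjacent iff they both are edges of $G[B]$ for some common biclique $B$ of $G$ (i.e. $L_G$ is the 2-section of $\mathcal{EB}(G)$). The clique hypergraph $\mathcal{K}(H)$ of a graph $H$ has vertex set $V(H)$ and the cliques of $H$ as hyperedges. The triangular prism is the graph on vertices $a,b,c,d,e,f$ consisting of the triangles $abc$ and $def$ together with the edges $ad,be,cf$. -}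

module Defs where

open import Data.Nat using (ℕ)
open import Data.Fin using (Fin; _<_; toℕ)
open import Data.Bool using (Bool; true; false; T)
open import Data.Product using (Σ; ∃; _×_; _,_)
open import Data.Sum using (_⊎_)
open import Relation.Binary.PropositionalEquality using (_≡_; _≢_)
open import Relation.Nullary using (¬_)
open import Function.Bundles using (_⇔_)

record Graph (n : ℕ) : Set where
  field
    adj    : Fin n → Fin n → Bool
    sym    : ∀ u v → adj u v ≡ adj v u
    irrefl : ∀ u → adj u u ≡ false
open Graph public

Adjacent : ∀ {n} → Graph n → Fin n → Fin n → Set
Adjacent G u v = T (adj G u v)

VSet : ℕ → Set
VSet n = Fin n → Bool

_∈ᵥ_ : ∀ {n} → Fin n → VSet n → Set
v ∈ᵥ S = T (S v)

InducesCompleteBipartite : ∀ {n} → Graph n → VSet n → Set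
InducesCompleteBipartite {n} G B =
  Σ (VSet n) λ X → Σ (VSet n) λ Y →
    (∀ v → (v ∈ᵥ B) ⇔ ((v ∈ᵥ X) ⊎ (v ∈ᵥ Y))) ×
    (∀ v → ¬ ((v ∈ᵥ X) × (v ∈ᵥ Y))) ×
    (∃ λ x → x ∈ᵥ X) ×
    (∃ λ y → y ∈ᵥ Y) ×
    (∀ x x' → x ∈ᵥ X → x' ∈ᵥ X → ¬ Adjacent G x x') ×
    (∀ y y' → y ∈ᵥ Y → y' ∈ᵥ Y → ¬ Adjacent G y y') ×
    (∀ x y → x ∈ᵥ X → y ∈ᵥ Y → Adjacent G x y)

IsBiclique : ∀ {n} → Graph n → VSet n → Set
IsBiclique {n} G B =
  InducesCompleteBipartite G B ×
  (∀ (B' : VSet n) → InducesCompleteBipartite G B' →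
     (∀ v → v ∈ᵥ B → v ∈ᵥ B') → ∀ v → v ∈ᵥ B' → v ∈ᵥ B)

-- Edges of G (each unordered edge {u,v} represented once, with u < v)

record Edge {n : ℕ} (G : Graph n) : Set where
  constructor edge
  field
    end₁  : Fin n
    end₂  : Fin n
    ord   : end₁ < end₂
    isAdj : Adjacent G end₁ end₂
open Edge public

_∈E[_] : ∀ {n} {G : Graph n} → Edge G → VSet n → Set
e ∈E[ B ] = (end₁ e ∈ᵥ B) × (end₂ e ∈ᵥ B)

ESet : ∀ {n} → Graph n → Set
ESet G = Edge G → Bool

_∈ₑ_ : ∀ {n} {G : Graph n} → Edge G → ESet G → Set
e ∈ₑ F = T (F e)

IsEBHyperedge : ∀ {n} (G : Graph n) → ESet G → Set
IsEBHyperedge {n} G F =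
  Σ (VSet n) λ B → IsBiclique G B × (∀ e → (e ∈ₑ F) ⇔ (e ∈E[ B ]))

LAdjacent : ∀ {n} (G : Graph n) → Edge G → Edge G → Set
LAdjacent {n} G e e' =
  Σ (VSet n) λ B → IsBiclique G B × (e ∈E[ B ]) × (e' ∈E[ B ])

IsCompleteInL : ∀ {n} (G : Graph n) → ESet G → Set
IsCompleteInL G K =
  ∀ e e' → e ∈ₑ K → e' ∈ₑ K → e ≢ e' → LAdjacent G e e'

IsCliqueOfL : ∀ {n} (G : Graph n) → ESet G → Set
IsCliqueOfL G K =
  (∃ λ e → e ∈ₑ K) ×
  IsCompleteInL G K ×
  (∀ e → (∀ e' → e' ∈ₑ K → e ≢ e' → LAdjacent G e e') → e ∈ₑ K)

EBEqualsKL : ∀ {n} → Graph n → Set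
EBEqualsKL G = ∀ (F : ESet G) → IsEBHyperedge G F ⇔ IsCliqueOfL G F

-- Triangular prism on vertices a,b,c,d,e,f = 0,1,2,3,4,5:
-- triangles abc, def and edges ad, be, cf.

prismAdjℕ : ℕ → ℕ → Bool
prismAdjℕ 0 1 = true
prismAdjℕ 1 0 = true
prismAdjℕ 0 2 = true
prismAdjℕ 2 0 = true
prismAdjℕ 1 2 = true
prismAdjℕ 2 1 = true
prismAdjℕ 3 4 = true
prismAdjℕ 4 3 = true
prismAdjℕ 3 5 = true
prismAdjℕ 5 3 = true
prismAdjℕ 4 5 = true
prismAdjℕ 5 4 = true
prismAdjℕ 0 3 = true
prismAdjℕ 3 0 = true
prismAdjℕ 1 4 = true
prismAdjℕ 4 1 = true
prismAdjℕ 2 5 = true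
prismAdjℕ 5 2 = true
prismAdjℕ _ _ = false

prismAdj : Fin 6 → Fin 6 → Bool
prismAdj i j = prismAdjℕ (toℕ i) (toℕ j)

HasInducedPrism : ∀ {n} → Graph n → Set
HasInducedPrism {n} G =
  Σ (Fin 6 → Fin n) λ f →
    (∀ i j → f i ≡ f j → i ≡ j) ×
    (∀ i j → adj G (f i) (f j) ≡ prismAdj i j)

-- A vertex set S induces a complete bipartite graph with both sides nonempty iff
-- it spans an edge and induces neither a triangle nor K₁ + K₂.  This property is
-- decidable and passes to every intermediate set between two such sets, so such
-- sets grow greedily into bicliques, and complete sets of L_G into cliques.
--
-- Without an induced prism, the vertices covered by a complete set K of L_G form
-- such a set: two edges uu′, vv′ of K with u ∼ v lie in a common biclique, which
-- forces u′ ∼ v′ and u ≁ v′, u′ ≁ v; so a triangle uvw of covered vertices,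
-- with its edges uu′, vv′, ww′ in K, would induce the prism uvw/u′v′w′.  Hence
-- the cliques of L_G are exactly the edge sets of bicliques.  Conversely, the
-- three matching edges of an induced prism are pairwise L_G-adjacent through its
-- three 4-cycles, but a biclique containing all of them would contain a triangle.

module Submission where

open import Data.Nat using (ℕ)
open import Data.Bool using (Bool; true; false; T; T?; _∨_)
open import Data.Bool.Properties using (T-∨; T-≡; T-irrelevant) renaming (_≟_ to _≟ᵇ_)
open import Data.Empty using (⊥-elim)
open import Data.Fin using (Fin; _≟_; _<?_)
open import Data.Fin.Patterns using (0F; 1F; 2F; 3F; 4F; 5F)
open import Data.Fin.Properties using (all?; any?; <-cmp; <-irrelevant)
open import Data.List using (List; []; _∷_; allFin; concatMap)
open import Data.List.Membership.Propositional using (lose) renaming (_∈_ to _∈ₗ_)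
open import Data.List.Membership.Propositional.Properties using (∈-allFin; ∈-concatMap⁺)
open import Data.List.Relation.Unary.All as All using ()
open import Data.List.Relation.Unary.Any as Any using (here; there)
open import Data.Product using (Σ; ∃; _×_; _,_; proj₁; proj₂)
open import Data.Sum using (_⊎_; inj₁; inj₂; [_,_])
open import Data.Unit using (tt)
open import Function.Bundles using (_⇔_; mk⇔; Equivalence)
open import Function.Base using (_∘_)
open import Relation.Binary.Definitions using (DecidableEquality; tri<; tri≈; tri>)
open import Relation.Binary.PropositionalEquality
  using (_≡_; _≢_; refl; sym; trans; cong; cong₂; subst)
open import Relation.Nullary using (¬_; Dec; yes; no)
open import Relation.Nullary.Decidable
  using (⌊_⌋; toWitness; fromWitness; map′; ¬?; _×-dec_; _→-dec_)
open import Defs hiding (sym)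

module BoolSubset {A : Set} (_≟_ : DecidableEquality A) where

  _∈_ : A → (A → Bool) → Set
  x ∈ S = T (S x)

  _⊆_ : (A → Bool) → (A → Bool) → Set
  S ⊆ U = ∀ x → x ∈ S → x ∈ U

  ⁅_⁆ : A → A → Bool
  ⁅ a ⁆ x = ⌊ x ≟ a ⌋

  _∪_ : (A → Bool) → (A → Bool) → A → Bool
  (S ∪ U) x = S x ∨ U x

  infixr 6 _∪_

  x∈⁅x⁆ : ∀ x → x ∈ ⁅ x ⁆
  x∈⁅x⁆ x = fromWitness refl

  ∈⁅⁆⁻ : ∀ {a x} → x ∈ ⁅ a ⁆ → x ≡ a
  ∈⁅⁆⁻ = toWitness

  ∈-∪ˡ : ∀ S U {x} → x ∈ S → x ∈ (S ∪ U)
  ∈-∪ˡ S U p = Equivalence.from T-∨ (inj₁ p)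

  ∈-∪ʳ : ∀ S U {x} → x ∈ U → x ∈ (S ∪ U)
  ∈-∪ʳ S U p = Equivalence.from T-∨ (inj₂ p)

  ∈-∪⁻ : ∀ S U {x} → x ∈ (S ∪ U) → x ∈ S ⊎ x ∈ U
  ∈-∪⁻ S U = Equivalence.to T-∨

  ∪-⊆ : ∀ {S M U} → S ⊆ U → M ⊆ U → (S ∪ M) ⊆ U
  ∪-⊆ {S} {M} S⊆U M⊆U x p with ∈-∪⁻ S M p
  ... | inj₁ x∈S = S⊆U x x∈S
  ... | inj₂ x∈M = M⊆U x x∈M

  ⁅⁆-⊆ : ∀ {a U} → a ∈ U → ⁅ a ⁆ ⊆ U
  ⁅⁆-⊆ a∈U x p with ∈⁅⁆⁻ p
  ... | refl = a∈U

  ∈-∪⁅⁆⁻ : ∀ S a x → x ∈ (S ∪ ⁅ a ⁆) → x ∈ S ⊎ x ≡ a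
  ∈-∪⁅⁆⁻ S a x p with ∈-∪⁻ S ⁅ a ⁆ p
  ... | inj₁ q = inj₁ q
  ... | inj₂ q = inj₂ (∈⁅⁆⁻ q)

  ∈-⁅⁆∪⁅⁆⁻ : ∀ a b x → x ∈ (⁅ a ⁆ ∪ ⁅ b ⁆) → x ≡ a ⊎ x ≡ b
  ∈-⁅⁆∪⁅⁆⁻ a b x p with ∈-∪⁻ ⁅ a ⁆ ⁅ b ⁆ p
  ... | inj₁ q = inj₁ (∈⁅⁆⁻ q)
  ... | inj₂ q = inj₂ (∈⁅⁆⁻ q)

  module GreedyExtension
    (xs : List A) (xs-complete : ∀ x → x ∈ₗ xs)
    (Good : (A → Bool) → Set) (good? : ∀ S → Dec (Good S))
    (interval-closed : ∀ {S M U} → Good S → Good U → S ⊆ M → M ⊆ U → Good M)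
    where

    step : (S : A → Bool) (a : A) → Dec (Good (S ∪ ⁅ a ⁆)) → A → Bool
    step S a (yes _) = S ∪ ⁅ a ⁆
    step S a (no _)  = S

    grow : (A → Bool) → List A → A → Bool
    grow S []       = S
    grow S (a ∷ as) = grow (step S a (good? (S ∪ ⁅ a ⁆))) as

    grow-good : ∀ {S} as → Good S → Good (grow S as)
    grow-good []                 g = g
    grow-good {S} (a ∷ as) g with good? (S ∪ ⁅ a ⁆)
    ... | yes g′ = grow-good as g′
    ... | no _   = grow-good as g

    ⊆-grow : ∀ S as → S ⊆ grow S as
    ⊆-grow S []       x p = p
    ⊆-grow S (a ∷ as) x p with good? (S ∪ ⁅ a ⁆)
    ... | yes _ = ⊆-grow (S ∪ ⁅ a ⁆) as x (∈-∪ˡ S ⁅ a ⁆ p)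
    ... | no _  = ⊆-grow S as x p

    -- An element of the list is rejected only if adding it already breaks
    -- Good, and then it cannot lie in any good superset.
    grow-maximal : ∀ {S U} as → Good S → Good U → grow S as ⊆ U →
                   ∀ x → x ∈ₗ as → x ∈ U → x ∈ grow S as
    grow-maximal {S} (a ∷ as) gS gU sub x x∈as x∈U with good? (S ∪ ⁅ a ⁆) | x∈as
    ... | yes _ | here refl = ⊆-grow (S ∪ ⁅ a ⁆) as x (∈-∪ʳ S ⁅ a ⁆ (x∈⁅x⁆ x))
    ... | yes g | there x∈as′ = grow-maximal as g gU sub x x∈as′ x∈U
    ... | no ¬g | here refl =
      ⊥-elim (¬g (interval-closed gS gU (λ y → ∈-∪ˡ S ⁅ a ⁆)
                   (∪-⊆ (λ y p → sub y (⊆-grow S as y p)) (⁅⁆-⊆ x∈U))))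
    ... | no _  | there x∈as′ = grow-maximal as gS gU sub x x∈as′ x∈U

    maximal-extension : ∀ {S} → Good S →
      Σ (A → Bool) λ M → Good M × S ⊆ M × (∀ U → Good U → M ⊆ U → U ⊆ M)
    maximal-extension {S} g =
      grow S xs , grow-good xs g , ⊆-grow S xs ,
      λ U gU sub x → grow-maximal xs g gU sub x (xs-complete x)

¬T⇒≡false : ∀ {b} → ¬ T b → b ≡ false
¬T⇒≡false {false} _  = refl
¬T⇒≡false {true}  ¬t = ⊥-elim (¬t tt)

prismAdj-separates : ∀ i j → (∀ k → prismAdj i k ≡ prismAdj j k) → i ≡ j
prismAdj-separates = toWitness {a? = all? λ i → all? λ j →
  all? (λ k → prismAdj i k ≟ᵇ prismAdj j k) →-dec i ≟ j} _

module _ {n : ℕ} (G : Graph n) where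

  open BoolSubset (_≟_ {n})

  Adj : Fin n → Fin n → Set
  Adj = Adjacent G

  adj-sym : ∀ {u v} → Adj u v → Adj v u
  adj-sym {u} {v} = subst T (Graph.sym G u v)

  adj-irrefl : ∀ {u} → ¬ Adj u u
  adj-irrefl {u} = subst T (irrefl G u)

  adj? : ∀ u v → Dec (Adj u v)
  adj? u v = T? (adj G u v)

  adj≡true : ∀ {u v} → Adj u v → adj G u v ≡ true
  adj≡true = Equivalence.to T-≡

  ¬adj⇒adj≡false : ∀ {u v} → ¬ Adj u v → adj G u v ≡ false
  ¬adj⇒adj≡false = ¬T⇒≡false

  -- Complete bipartite vertex sets

  SpansEdge TriangleFree CoP₃Free : VSet n → Set
  SpansEdge S = Σ (Fin n) λ u → Σ (Fin n) λ v → u ∈ S × v ∈ S × Adj u v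
  TriangleFree S = ∀ u v w → u ∈ S → v ∈ S → w ∈ S → Adj u v → Adj v w → ¬ Adj u w
  -- No induced K₁ + K₂: a vertex missing one end of an edge sees the other end.
  CoP₃Free S = ∀ u v w → u ∈ S → v ∈ S → w ∈ S → Adj u v → ¬ Adj u w → Adj v w

  record CompleteBipartite (S : VSet n) : Set where
    constructor complete-bipartite
    field
      spans-edge    : SpansEdge S
      triangle-free : TriangleFree S
      coP₃-free     : CoP₃Free S
  open CompleteBipartite public

  completeBipartite? : ∀ S → Dec (CompleteBipartite S)
  completeBipartite? S =
    map′ (λ (e , t , c) → complete-bipartite e t c)
         (λ cb → spans-edge cb , triangle-free cb , coP₃-free cb)
         (spansEdge? ×-dec triangleFree? ×-dec coP₃Free?)
    where
    _∈?_ : ∀ v S → Dec (v ∈ S)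
    v ∈? S = T? (S v)
    spansEdge? : Dec (SpansEdge S)
    spansEdge? = any? λ u → any? λ v → u ∈? S ×-dec v ∈? S ×-dec adj? u v
    triangleFree? : Dec (TriangleFree S)
    triangleFree? = all? λ u → all? λ v → all? λ w →
      u ∈? S →-dec v ∈? S →-dec w ∈? S →-dec adj? u v →-dec adj? v w →-dec ¬? (adj? u w)
    coP₃Free? : Dec (CoP₃Free S)
    coP₃Free? = all? λ u → all? λ v → all? λ w →
      u ∈? S →-dec v ∈? S →-dec w ∈? S →-dec adj? u v →-dec ¬? (adj? u w) →-dec adj? v w

  induces⇒completeBipartite : ∀ {S} → InducesCompleteBipartite G S → CompleteBipartite S
  induces⇒completeBipartite {S} (X , Y , cover , _ , (x , x∈X) , (y , y∈Y) , indX , indY , complete) =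
    complete-bipartite (x , y , into (inj₁ x∈X) , into (inj₂ y∈Y) , complete x y x∈X y∈Y)
                       no-triangle no-coP₃
    where
    into : ∀ {v} → v ∈ X ⊎ v ∈ Y → v ∈ S
    into {v} = Equivalence.from (cover v)
    side : ∀ {v} → v ∈ S → v ∈ X ⊎ v ∈ Y
    side {v} = Equivalence.to (cover v)
    no-triangle : TriangleFree S
    no-triangle u v w u∈S v∈S w∈S uv vw uw with side u∈S | side v∈S | side w∈S
    ... | inj₁ u∈X | inj₁ v∈X | _        = indX u v u∈X v∈X uv
    ... | inj₂ u∈Y | inj₂ v∈Y | _        = indY u v u∈Y v∈Y uv
    ... | _        | inj₁ v∈X | inj₁ w∈X = indX v w v∈X w∈X vw
    ... | _        | inj₂ v∈Y | inj₂ w∈Y = indY v w v∈Y w∈Y vw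
    ... | inj₁ u∈X | inj₂ _   | inj₁ w∈X = indX u w u∈X w∈X uw
    ... | inj₂ u∈Y | inj₁ _   | inj₂ w∈Y = indY u w u∈Y w∈Y uw
    no-coP₃ : CoP₃Free S
    no-coP₃ u v w u∈S v∈S w∈S uv ¬uw with side u∈S | side v∈S | side w∈S
    ... | inj₁ u∈X | inj₁ v∈X | _        = ⊥-elim (indX u v u∈X v∈X uv)
    ... | inj₂ u∈Y | inj₂ v∈Y | _        = ⊥-elim (indY u v u∈Y v∈Y uv)
    ... | inj₁ _   | inj₂ v∈Y | inj₁ w∈X = adj-sym (complete w v w∈X v∈Y)
    ... | inj₁ u∈X | inj₂ _   | inj₂ w∈Y = ⊥-elim (¬uw (complete u w u∈X w∈Y))
    ... | inj₂ u∈Y | inj₁ _   | inj₁ w∈X = ⊥-elim (¬uw (adj-sym (complete w u w∈X u∈Y)))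
    ... | inj₂ _   | inj₁ v∈X | inj₂ w∈Y = complete v w v∈X w∈Y

  completeBipartite⇒induces : ∀ {S} → CompleteBipartite S → InducesCompleteBipartite G S
  completeBipartite⇒induces {S} (complete-bipartite (a , b , a∈S , b∈S , ab) triangle-free coP₃-free) =
    X , Y , cover , disjoint , (a , fromWitness (a∈S , adj-irrefl)) , (b , fromWitness (b∈S , adj-sym ab)) ,
    indX , indY , complete
    where
    X Y : VSet n
    X v = ⌊ T? (S v) ×-dec ¬? (adj? v a) ⌋
    Y v = ⌊ T? (S v) ×-dec adj? v a ⌋
    cover : ∀ v → v ∈ S ⇔ (v ∈ X ⊎ v ∈ Y)
    cover v = mk⇔ split [ proj₁ ∘ toWitness , proj₁ ∘ toWitness ]
      where
      split : v ∈ S → v ∈ X ⊎ v ∈ Y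
      split v∈S with adj? v a
      ... | yes va = inj₂ (fromWitness (v∈S , va))
      ... | no ¬va = inj₁ (fromWitness (v∈S , ¬va))
    disjoint : ∀ v → ¬ (v ∈ X × v ∈ Y)
    disjoint v (p , q) = proj₂ (toWitness p) (proj₂ (toWitness q))
    indX : ∀ x x′ → x ∈ X → x′ ∈ X → ¬ Adj x x′
    indX x x′ p q xx′ with toWitness p | toWitness q
    ... | x∈S , ¬xa | x′∈S , ¬x′a = ¬x′a (coP₃-free x x′ a x∈S x′∈S a∈S xx′ ¬xa)
    indY : ∀ y y′ → y ∈ Y → y′ ∈ Y → ¬ Adj y y′
    indY y y′ p q yy′ with toWitness p | toWitness q
    ... | y∈S , ya | y′∈S , y′a = triangle-free y y′ a y∈S y′∈S a∈S yy′ y′a ya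
    complete : ∀ x y → x ∈ X → y ∈ Y → Adj x y
    complete x y p q with toWitness p | toWitness q
    ... | x∈S , ¬xa | y∈S , ya = adj-sym (coP₃-free a y x a∈S y∈S x∈S (adj-sym ya) (¬xa ∘ adj-sym))

  spansEdge-mono : ∀ {S U} → S ⊆ U → SpansEdge S → SpansEdge U
  spansEdge-mono S⊆U (u , v , u∈S , v∈S , uv) = u , v , S⊆U u u∈S , S⊆U v v∈S , uv

  completeBipartite-⊆ : ∀ {S U} → CompleteBipartite U → S ⊆ U → SpansEdge S → CompleteBipartite S
  completeBipartite-⊆ (complete-bipartite _ t c) S⊆U e = complete-bipartite e
    (λ u v w p q r → t u v w (S⊆U u p) (S⊆U v q) (S⊆U w r))
    (λ u v w p q r → c u v w (S⊆U u p) (S⊆U v q) (S⊆U w r))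

  completeBipartite-between : ∀ {S M U} → CompleteBipartite S → CompleteBipartite U →
                              S ⊆ M → M ⊆ U → CompleteBipartite M
  completeBipartite-between cbS cbU S⊆M M⊆U =
    completeBipartite-⊆ cbU M⊆U (spansEdge-mono S⊆M (spans-edge cbS))

  completeBipartite-no-isolated : ∀ {S v} → CompleteBipartite S → v ∈ S →
                                  Σ (Fin n) λ u → u ∈ S × Adj v u
  completeBipartite-no-isolated {v = v} (complete-bipartite (x , y , x∈S , y∈S , xy) _ c) v∈S
    with adj? v x
  ... | yes vx = x , x∈S , vx
  ... | no ¬vx = y , y∈S , adj-sym (c x y v x∈S y∈S v∈S xy (¬vx ∘ adj-sym))

  private
    module BicliqueSearch = GreedyExtension (allFin n) ∈-allFin
      CompleteBipartite completeBipartite? completeBipartite-between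

  extend-to-biclique : ∀ {S} → CompleteBipartite S → Σ (VSet n) λ B → IsBiclique G B × S ⊆ B
  extend-to-biclique cb with BicliqueSearch.maximal-extension cb
  ... | B , cbB , S⊆B , maximal =
    B , (completeBipartite⇒induces cbB , λ U icb → maximal U (induces⇒completeBipartite icb)) , S⊆B

  biclique⇒completeBipartite : ∀ {B} → IsBiclique G B → CompleteBipartite B
  biclique⇒completeBipartite = induces⇒completeBipartite ∘ proj₁

  C4-inducesCompleteBipartite : ∀ {a b c d} → Adj a b → Adj b c → Adj c d → Adj d a →
    ¬ Adj a c → ¬ Adj b d → InducesCompleteBipartite G ((⁅ a ⁆ ∪ ⁅ c ⁆) ∪ (⁅ b ⁆ ∪ ⁅ d ⁆))
  C4-inducesCompleteBipartite {a} {b} {c} {d} ab bc cd da ¬ac ¬bd =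
    X , Y , (λ v → mk⇔ (∈-∪⁻ X Y {v}) [ ∈-∪ˡ X Y {v} , ∈-∪ʳ X Y {v} ]) , disjoint ,
    (a , ∈-∪ˡ ⁅ a ⁆ ⁅ c ⁆ (x∈⁅x⁆ a)) , (b , ∈-∪ˡ ⁅ b ⁆ ⁅ d ⁆ (x∈⁅x⁆ b)) , indX , indY , complete
    where
    X Y : VSet n
    X = ⁅ a ⁆ ∪ ⁅ c ⁆
    Y = ⁅ b ⁆ ∪ ⁅ d ⁆
    disjoint : ∀ v → ¬ (v ∈ X × v ∈ Y)
    disjoint v (p , q) with ∈-⁅⁆∪⁅⁆⁻ a c v p | ∈-⁅⁆∪⁅⁆⁻ b d v q
    ... | inj₁ refl | inj₁ refl = adj-irrefl ab
    ... | inj₁ refl | inj₂ refl = adj-irrefl da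
    ... | inj₂ refl | inj₁ refl = adj-irrefl bc
    ... | inj₂ refl | inj₂ refl = adj-irrefl cd
    indX : ∀ x x′ → x ∈ X → x′ ∈ X → ¬ Adj x x′
    indX x x′ p q with ∈-⁅⁆∪⁅⁆⁻ a c x p | ∈-⁅⁆∪⁅⁆⁻ a c x′ q
    ... | inj₁ refl | inj₁ refl = adj-irrefl
    ... | inj₁ refl | inj₂ refl = ¬ac
    ... | inj₂ refl | inj₁ refl = ¬ac ∘ adj-sym
    ... | inj₂ refl | inj₂ refl = adj-irrefl
    indY : ∀ y y′ → y ∈ Y → y′ ∈ Y → ¬ Adj y y′
    indY y y′ p q with ∈-⁅⁆∪⁅⁆⁻ b d y p | ∈-⁅⁆∪⁅⁆⁻ b d y′ q
    ... | inj₁ refl | inj₁ refl = adj-irrefl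
    ... | inj₁ refl | inj₂ refl = ¬bd
    ... | inj₂ refl | inj₁ refl = ¬bd ∘ adj-sym
    ... | inj₂ refl | inj₂ refl = adj-irrefl
    complete : ∀ x y → x ∈ X → y ∈ Y → Adj x y
    complete x y p q with ∈-⁅⁆∪⁅⁆⁻ a c x p | ∈-⁅⁆∪⁅⁆⁻ b d y q
    ... | inj₁ refl | inj₁ refl = ab
    ... | inj₁ refl | inj₂ refl = adj-sym da
    ... | inj₂ refl | inj₁ refl = adj-sym bc
    ... | inj₂ refl | inj₂ refl = cd

  edge-ext : ∀ {e f : Edge G} → end₁ e ≡ end₁ f → end₂ e ≡ end₂ f → e ≡ f
  edge-ext {edge a b p q} {edge .a .b p′ q′} refl refl =
    cong₂ (edge a b) (<-irrelevant p p′) (T-irrelevant q q′)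

  _≟E_ : DecidableEquality (Edge G)
  e ≟E f with end₁ e ≟ end₁ f | end₂ e ≟ end₂ f
  ... | yes p | yes q = yes (edge-ext p q)
  ... | no ¬p | _     = no (¬p ∘ cong end₁)
  ... | yes _ | no ¬q = no (¬q ∘ cong end₂)

  data Joins (e : Edge G) (x y : Fin n) : Set where
    forward  : end₁ e ≡ x → end₂ e ≡ y → Joins e x y
    backward : end₁ e ≡ y → end₂ e ≡ x → Joins e x y

  joins-ends : ∀ e → Joins e (end₁ e) (end₂ e)
  joins-ends e = forward refl refl

  joins-sym : ∀ {e x y} → Joins e x y → Joins e y x
  joins-sym (forward p q)  = backward p q
  joins-sym (backward p q) = forward p q

  joins-adj : ∀ {e x y} → Joins e x y → Adj x y
  joins-adj {e} (forward refl refl)  = isAdj e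
  joins-adj {e} (backward refl refl) = adj-sym (isAdj e)

  joins-∈ : ∀ {e x y S} → Joins e x y → e ∈E[ S ] → x ∈ S × y ∈ S
  joins-∈ (forward refl refl)  (p , q) = p , q
  joins-∈ (backward refl refl) (p , q) = q , p

  joins-∈E : ∀ {e x y S} → Joins e x y → x ∈ S → y ∈ S → e ∈E[ S ]
  joins-∈E (forward refl refl)  p q = p , q
  joins-∈E (backward refl refl) p q = q , p

  joins-endpoint : ∀ {e x y u w} → Joins e x y → Joins e u w → u ≡ x ⊎ u ≡ y
  joins-endpoint (forward refl refl)  (forward p _)  = inj₁ (sym p)
  joins-endpoint (forward refl refl)  (backward _ p) = inj₂ (sym p)
  joins-endpoint (backward refl refl) (forward p _)  = inj₂ (sym p)
  joins-endpoint (backward refl refl) (backward _ p) = inj₁ (sym p)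

  edge-joining : ∀ {x y} → Adj x y → Σ (Edge G) λ e → Joins e x y
  edge-joining {x} {y} xy with <-cmp x y
  ... | tri< x<y _ _   = edge x y x<y xy , forward refl refl
  ... | tri≈ _ refl _ = ⊥-elim (adj-irrefl xy)
  ... | tri> _ _ y<x   = edge y x y<x (adj-sym xy) , backward refl refl

  incident? : ∀ x e → Dec (∃ (Joins e x))
  incident? x e with end₁ e ≟ x | end₂ e ≟ x
  ... | yes p | _     = yes (end₂ e , forward p refl)
  ... | no _  | yes q = yes (end₁ e , backward refl q)
  ... | no ¬p | no ¬q = no λ where
    (_ , forward p _)  → ¬p p
    (_ , backward _ q) → ¬q q

  edgesBetween : Fin n → Fin n → List (Edge G)
  edgesBetween i j with i <? j | adj? i j
  ... | yes i<j | yes ij = edge i j i<j ij ∷ []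
  ... | _       | _      = []

  ∈-edgesBetween : ∀ e → e ∈ₗ edgesBetween (end₁ e) (end₂ e)
  ∈-edgesBetween (edge i j i<j ij) with i <? j | adj? i j
  ... | yes i<j′ | yes ij′ = here (cong₂ (edge i j) (<-irrelevant i<j i<j′) (T-irrelevant ij ij′))
  ... | no ¬i<j  | _       = ⊥-elim (¬i<j i<j)
  ... | yes _    | no ¬ij  = ⊥-elim (¬ij ij)

  allEdges : List (Edge G)
  allEdges = concatMap (λ i → concatMap (edgesBetween i) (allFin n)) (allFin n)

  ∈-allEdges : ∀ e → e ∈ₗ allEdges
  ∈-allEdges e = ∈-concatMap⁺ _ (lose (∈-allFin (end₁ e))
                   (∈-concatMap⁺ _ (lose (∈-allFin (end₂ e)) (∈-edgesBetween e))))

  ∀-edges? : {P : Edge G → Set} → (∀ e → Dec (P e)) → Dec (∀ e → P e)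
  ∀-edges? P? = map′ (λ ps e → All.lookup ps (∈-allEdges e)) (λ p → All.tabulate λ {e} _ → p e)
                     (All.all? P? allEdges)

  ∈E-mono : ∀ {S U} → S ⊆ U → ∀ (e : Edge G) → e ∈E[ S ] → e ∈E[ U ]
  ∈E-mono S⊆U e (p , q) = S⊆U (end₁ e) p , S⊆U (end₂ e) q

  ∈E⇒spansEdge : ∀ {S} (e : Edge G) → e ∈E[ S ] → SpansEdge S
  ∈E⇒spansEdge e (p , q) = end₁ e , end₂ e , p , q , isAdj e

  endpoints : Edge G → VSet n
  endpoints e = ⁅ end₁ e ⁆ ∪ ⁅ end₂ e ⁆

  ∈E-endpoints : ∀ e → e ∈E[ endpoints e ]
  ∈E-endpoints e = ∈-∪ˡ ⁅ end₁ e ⁆ ⁅ end₂ e ⁆ {end₁ e} (x∈⁅x⁆ (end₁ e)) ,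
                   ∈-∪ʳ ⁅ end₁ e ⁆ ⁅ end₂ e ⁆ {end₂ e} (x∈⁅x⁆ (end₂ e))

  endpoints-⊆ : ∀ {S} (e : Edge G) → e ∈E[ S ] → endpoints e ⊆ S
  endpoints-⊆ e (p , q) = ∪-⊆ (⁅⁆-⊆ p) (⁅⁆-⊆ q)

  LAdjacent-sym : ∀ {e f : Edge G} → LAdjacent G e f → LAdjacent G f e
  LAdjacent-sym (B , bic , e∈B , f∈B) = B , bic , f∈B , e∈B

  completeBipartite⇒LAdjacent : ∀ {S} → CompleteBipartite S → ∀ e f → e ∈E[ S ] → f ∈E[ S ] →
                                LAdjacent G e f
  completeBipartite⇒LAdjacent cb e f e∈S f∈S with extend-to-biclique cb
  ... | B , bic , S⊆B = B , bic , ∈E-mono S⊆B e e∈S , ∈E-mono S⊆B f f∈S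

  LAdjacent⇔completeBipartite : ∀ e f → LAdjacent G e f ⇔ CompleteBipartite (endpoints e ∪ endpoints f)
  LAdjacent⇔completeBipartite e f = mk⇔
    (λ (B , bic , e∈B , f∈B) →
       completeBipartite-⊆ (biclique⇒completeBipartite bic)
         (∪-⊆ (endpoints-⊆ e e∈B) (endpoints-⊆ f f∈B)) (∈E⇒spansEdge e e∈ef))
    (λ cb → completeBipartite⇒LAdjacent cb e f e∈ef
              (∈E-mono (λ x → ∈-∪ʳ (endpoints e) (endpoints f) {x}) f (∈E-endpoints f)))
    where
    e∈ef : e ∈E[ endpoints e ∪ endpoints f ]
    e∈ef = ∈E-mono (λ x → ∈-∪ˡ (endpoints e) (endpoints f) {x}) e (∈E-endpoints e)

  LAdjacent? : ∀ e f → Dec (LAdjacent G e f)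
  LAdjacent? e f = map′ (Equivalence.from (LAdjacent⇔completeBipartite e f))
                        (Equivalence.to (LAdjacent⇔completeBipartite e f)) (completeBipartite? _)

  C4-LAdjacent : ∀ {a b c d e f} → Adj a b → Adj b c → Adj c d → Adj d a →
                 ¬ Adj a c → ¬ Adj b d → Joins e a b → Joins f c d → LAdjacent G e f
  C4-LAdjacent {a} {b} {c} {d} {e} {f} ab bc cd da ¬ac ¬bd je jf =
    completeBipartite⇒LAdjacent
      (induces⇒completeBipartite (C4-inducesCompleteBipartite ab bc cd da ¬ac ¬bd)) e f
      (joins-∈E {S = X ∪ Y} je a∈ b∈) (joins-∈E {S = X ∪ Y} jf c∈ d∈)
    where
    X Y : VSet n
    X = ⁅ a ⁆ ∪ ⁅ c ⁆
    Y = ⁅ b ⁆ ∪ ⁅ d ⁆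
    a∈ : a ∈ (X ∪ Y)
    a∈ = ∈-∪ˡ X Y {a} (∈-∪ˡ ⁅ a ⁆ ⁅ c ⁆ (x∈⁅x⁆ a))
    c∈ : c ∈ (X ∪ Y)
    c∈ = ∈-∪ˡ X Y {c} (∈-∪ʳ ⁅ a ⁆ ⁅ c ⁆ (x∈⁅x⁆ c))
    b∈ : b ∈ (X ∪ Y)
    b∈ = ∈-∪ʳ X Y {b} (∈-∪ˡ ⁅ b ⁆ ⁅ d ⁆ (x∈⁅x⁆ b))
    d∈ : d ∈ (X ∪ Y)
    d∈ = ∈-∪ʳ X Y {d} (∈-∪ʳ ⁅ b ⁆ ⁅ d ⁆ (x∈⁅x⁆ d))

  -- Cliques of L_G

  module E = BoolSubset _≟E_

  complete? : ∀ K → Dec (IsCompleteInL G K)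
  complete? K = ∀-edges? λ e → ∀-edges? λ f →
    T? (K e) →-dec T? (K f) →-dec ¬? (e ≟E f) →-dec LAdjacent? e f

  complete-⊆ : ∀ {K U} → IsCompleteInL G U → K E.⊆ U → IsCompleteInL G K
  complete-⊆ cU K⊆U e f e∈K f∈K = cU e f (K⊆U e e∈K) (K⊆U f f∈K)

  ⁅⁆-complete : ∀ e → IsCompleteInL G E.⁅ e ⁆
  ⁅⁆-complete e f f′ p q f≢f′ = ⊥-elim (f≢f′ (trans (E.∈⁅⁆⁻ p) (sym (E.∈⁅⁆⁻ q))))

  complete-∪⁅⁆ : ∀ {K e} → IsCompleteInL G K → (∀ f → f ∈ₑ K → e ≢ f → LAdjacent G e f) →
                 IsCompleteInL G (K E.∪ E.⁅ e ⁆)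
  complete-∪⁅⁆ {K} {e} cK e∼K f f′ p q f≢f′ with E.∈-∪⁅⁆⁻ K e f p | E.∈-∪⁅⁆⁻ K e f′ q
  ... | inj₁ f∈K  | inj₁ f′∈K = cK f f′ f∈K f′∈K f≢f′
  ... | inj₁ f∈K  | inj₂ refl = LAdjacent-sym {e} {f} (e∼K f f∈K (f≢f′ ∘ sym))
  ... | inj₂ refl | inj₁ f′∈K = e∼K f′ f′∈K f≢f′
  ... | inj₂ refl | inj₂ refl = ⊥-elim (f≢f′ refl)

  private
    module CliqueSearch = E.GreedyExtension allEdges ∈-allEdges
      (IsCompleteInL G) complete? (λ _ cU _ M⊆U → complete-⊆ cU M⊆U)

  extend-to-clique : ∀ {K} → IsCompleteInL G K → (∃ λ e → e ∈ₑ K) →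
                     Σ (ESet G) λ C → IsCliqueOfL G C × K E.⊆ C
  extend-to-clique cK (e , e∈K) with CliqueSearch.maximal-extension cK
  ... | C , cC , K⊆C , maximal = C , ((e , K⊆C e e∈K) , cC , maximal′) , K⊆C
    where
    maximal′ : ∀ f → (∀ f′ → f′ ∈ₑ C → f ≢ f′ → LAdjacent G f f′) → f ∈ₑ C
    maximal′ f f∼C = maximal (C E.∪ E.⁅ f ⁆) (complete-∪⁅⁆ cC f∼C) (λ x → E.∈-∪ˡ C E.⁅ f ⁆ {x})
                       f (E.∈-∪ʳ C E.⁅ f ⁆ {f} (E.x∈⁅x⁆ f))

  record Prism : Set where
    constructor prism
    field
      a b c d e f : Fin n
      ab : Adj a b
      ac : Adj a c
      bc : Adj b c
      de : Adj d e
      df : Adj d f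
      ef : Adj e f
      ad : Adj a d
      be : Adj b e
      cf : Adj c f
      ¬ae : ¬ Adj a e
      ¬af : ¬ Adj a f
      ¬bd : ¬ Adj b d
      ¬bf : ¬ Adj b f
      ¬cd : ¬ Adj c d
      ¬ce : ¬ Adj c e

  hasInducedPrism⇒Prism : HasInducedPrism G → Prism
  hasInducedPrism⇒Prism (g , _ , adj≡) =
    prism (g 0F) (g 1F) (g 2F) (g 3F) (g 4F) (g 5F)
      (edge′ 0F 1F _) (edge′ 0F 2F _) (edge′ 1F 2F _) (edge′ 3F 4F _) (edge′ 3F 5F _) (edge′ 4F 5F _)
      (edge′ 0F 3F _) (edge′ 1F 4F _) (edge′ 2F 5F _)
      (non-edge 0F 4F λ ()) (non-edge 0F 5F λ ()) (non-edge 1F 3F λ ())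
      (non-edge 1F 5F λ ()) (non-edge 2F 3F λ ()) (non-edge 2F 4F λ ())
    where
    edge′ : ∀ i j → T (prismAdj i j) → Adj (g i) (g j)
    edge′ i j = subst T (sym (adj≡ i j))
    non-edge : ∀ i j → ¬ T (prismAdj i j) → ¬ Adj (g i) (g j)
    non-edge i j ¬p = ¬p ∘ subst T (adj≡ i j)

  module _ (P : Prism) where
    open Prism P

    prism-vertex : Fin 6 → Fin n
    prism-vertex 0F = a
    prism-vertex 1F = b
    prism-vertex 2F = c
    prism-vertex 3F = d
    prism-vertex 4F = e
    prism-vertex 5F = f

    prism-vertex-adj : ∀ i j → adj G (prism-vertex i) (prism-vertex j) ≡ prismAdj i j
    prism-vertex-adj 0F 0F = irrefl G a
    prism-vertex-adj 0F 1F = adj≡true ab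
    prism-vertex-adj 0F 2F = adj≡true ac
    prism-vertex-adj 0F 3F = adj≡true ad
    prism-vertex-adj 0F 4F = ¬adj⇒adj≡false ¬ae
    prism-vertex-adj 0F 5F = ¬adj⇒adj≡false ¬af
    prism-vertex-adj 1F 0F = adj≡true (adj-sym ab)
    prism-vertex-adj 1F 1F = irrefl G b
    prism-vertex-adj 1F 2F = adj≡true bc
    prism-vertex-adj 1F 3F = ¬adj⇒adj≡false ¬bd
    prism-vertex-adj 1F 4F = adj≡true be
    prism-vertex-adj 1F 5F = ¬adj⇒adj≡false ¬bf
    prism-vertex-adj 2F 0F = adj≡true (adj-sym ac)
    prism-vertex-adj 2F 1F = adj≡true (adj-sym bc)
    prism-vertex-adj 2F 2F = irrefl G c
    prism-vertex-adj 2F 3F = ¬adj⇒adj≡false ¬cd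
    prism-vertex-adj 2F 4F = ¬adj⇒adj≡false ¬ce
    prism-vertex-adj 2F 5F = adj≡true cf
    prism-vertex-adj 3F 0F = adj≡true (adj-sym ad)
    prism-vertex-adj 3F 1F = ¬adj⇒adj≡false (¬bd ∘ adj-sym)
    prism-vertex-adj 3F 2F = ¬adj⇒adj≡false (¬cd ∘ adj-sym)
    prism-vertex-adj 3F 3F = irrefl G d
    prism-vertex-adj 3F 4F = adj≡true de
    prism-vertex-adj 3F 5F = adj≡true df
    prism-vertex-adj 4F 0F = ¬adj⇒adj≡false (¬ae ∘ adj-sym)
    prism-vertex-adj 4F 1F = adj≡true (adj-sym be)
    prism-vertex-adj 4F 2F = ¬adj⇒adj≡false (¬ce ∘ adj-sym)
    prism-vertex-adj 4F 3F = adj≡true (adj-sym de)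
    prism-vertex-adj 4F 4F = irrefl G e
    prism-vertex-adj 4F 5F = adj≡true ef
    prism-vertex-adj 5F 0F = ¬adj⇒adj≡false (¬af ∘ adj-sym)
    prism-vertex-adj 5F 1F = ¬adj⇒adj≡false (¬bf ∘ adj-sym)
    prism-vertex-adj 5F 2F = adj≡true (adj-sym cf)
    prism-vertex-adj 5F 3F = adj≡true (adj-sym df)
    prism-vertex-adj 5F 4F = adj≡true (adj-sym ef)
    prism-vertex-adj 5F 5F = irrefl G f

  Prism⇒hasInducedPrism : Prism → HasInducedPrism G
  Prism⇒hasInducedPrism P = prism-vertex P , injective , prism-vertex-adj P
    where
    injective : ∀ i j → prism-vertex P i ≡ prism-vertex P j → i ≡ j
    injective i j same = prismAdj-separates i j λ k →
      trans (sym (prism-vertex-adj P i k))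
            (trans (cong (λ v → adj G v (prism-vertex P k)) same) (prism-vertex-adj P j k))

  -- Vertices covered by a complete set of L_G

  covered : ESet G → VSet n
  covered K v = ⌊ Any.any? (λ e → T? (K e) ×-dec incident? v e) allEdges ⌋

  covered⁺ : ∀ K {e x y} → e ∈ₑ K → Joins e x y → x ∈ covered K
  covered⁺ K {e} e∈K j = fromWitness (lose (∈-allEdges e) (e∈K , _ , j))

  covered⁻ : ∀ K {x} → x ∈ covered K → Σ (Edge G) λ e → e ∈ₑ K × ∃ (Joins e x)
  covered⁻ K x∈ = Any.satisfied (toWitness x∈)

  ∈E-covered : ∀ K e → e ∈ₑ K → e ∈E[ covered K ]
  ∈E-covered K e e∈K = covered⁺ K e∈K (joins-ends e) , covered⁺ K e∈K (joins-sym (joins-ends e))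

  module _ (prism-free : ¬ HasInducedPrism G) {K : ESet G} (K-complete : IsCompleteInL G K) where

    private
      same-or-shared : ∀ {e f} → e ∈ₑ K → f ∈ₑ K →
        e ≡ f ⊎ Σ (VSet n) λ B → CompleteBipartite B × e ∈E[ B ] × f ∈E[ B ]
      same-or-shared {e} {f} e∈K f∈K with e ≟E f
      ... | yes e≡f = inj₁ e≡f
      ... | no e≢f with K-complete e f e∈K f∈K e≢f
      ...   | B , bic , e∈B , f∈B = inj₂ (B , biclique⇒completeBipartite bic , e∈B , f∈B)

      no-common-neighbour : ∀ {e f a b x x′} → e ∈ₑ K → f ∈ₑ K → Joins e a b → Joins f x x′ →
                            Adj x a → ¬ Adj x b
      no-common-neighbour e∈K f∈K jab jx xa xb with same-or-shared e∈K f∈K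
      ... | inj₁ refl = [ (λ { refl → adj-irrefl xa }) , (λ { refl → adj-irrefl xb }) ] (joins-endpoint jab jx)
      ... | inj₂ (B , cb , e∈B , f∈B) =
        triangle-free cb _ _ _ (proj₁ (joins-∈ jab e∈B)) (proj₂ (joins-∈ jab e∈B)) (proj₁ (joins-∈ jx f∈B))
          (joins-adj jab) (adj-sym xb) (adj-sym xa)

      square : ∀ {e₁ e₂ u u′ v v′} → e₁ ∈ₑ K → e₂ ∈ₑ K → e₁ ≢ e₂ → Joins e₁ u u′ → Joins e₂ v v′ →
               Adj u v → Adj u′ v′ × ¬ Adj u v′ × ¬ Adj u′ v
      square {u = u} {u′} {v} {v′} e₁∈K e₂∈K e₁≢e₂ j₁ j₂ uv with same-or-shared e₁∈K e₂∈K
      ... | inj₁ e₁≡e₂ = ⊥-elim (e₁≢e₂ e₁≡e₂)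
      ... | inj₂ (B , cb , e₁∈B , e₂∈B) =
        adj-sym (coP₃-free cb _ _ _ v∈B v′∈B u′∈B (joins-adj j₂) (¬u′v ∘ adj-sym)) , ¬uv′ , ¬u′v
        where
        u∈B = proj₁ (joins-∈ j₁ e₁∈B)
        u′∈B = proj₂ (joins-∈ j₁ e₁∈B)
        v∈B = proj₁ (joins-∈ j₂ e₂∈B)
        v′∈B = proj₂ (joins-∈ j₂ e₂∈B)
        ¬u′v : ¬ Adj u′ v
        ¬u′v u′v = triangle-free cb _ _ _ u∈B u′∈B v∈B (joins-adj j₁) u′v uv
        ¬uv′ : ¬ Adj u v′
        ¬uv′ = triangle-free cb _ _ _ u∈B v∈B v′∈B uv (joins-adj j₂)

      triangle-edges-distinct : ∀ {e₁ e₂ e₃ u u′ v v′ w w′} → e₁ ∈ₑ K → e₃ ∈ₑ K →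
        Joins e₁ u u′ → Joins e₂ v v′ → Joins e₃ w w′ → Adj u v → Adj v w → Adj u w → e₁ ≢ e₂
      triangle-edges-distinct e₁∈K e₃∈K j₁ j₂ j₃ uv vw uw refl with joins-endpoint j₁ j₂
      ... | inj₁ refl = adj-irrefl uv
      ... | inj₂ refl = no-common-neighbour e₁∈K e₃∈K j₁ j₃ (adj-sym uw) (adj-sym vw)

      covered-triangle-free : TriangleFree (covered K)
      covered-triangle-free u v w u∈ v∈ w∈ uv vw uw
        with covered⁻ K u∈ | covered⁻ K v∈ | covered⁻ K w∈
      ... | e₁ , e₁∈K , u′ , j₁ | e₂ , e₂∈K , v′ , j₂ | e₃ , e₃∈K , w′ , j₃
        with square e₁∈K e₂∈K (triangle-edges-distinct e₁∈K e₃∈K j₁ j₂ j₃ uv vw uw) j₁ j₂ uv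
           | square e₂∈K e₃∈K (triangle-edges-distinct e₂∈K e₁∈K j₂ j₃ j₁ vw (adj-sym uw) (adj-sym uv)) j₂ j₃ vw
           | square e₁∈K e₃∈K (triangle-edges-distinct e₁∈K e₂∈K j₁ j₃ j₂ uw (adj-sym vw) uv) j₁ j₃ uw
      ... | u′v′ , ¬uv′ , ¬u′v | v′w′ , ¬vw′ , ¬v′w | u′w′ , ¬uw′ , ¬u′w =
        prism-free (Prism⇒hasInducedPrism (prism u v w u′ v′ w′ uv uw vw u′v′ u′w′ v′w′
          (joins-adj j₁) (joins-adj j₂) (joins-adj j₃)
          ¬uv′ ¬uw′ (¬u′v ∘ adj-sym) ¬vw′ (¬u′w ∘ adj-sym) (¬v′w ∘ adj-sym)))

      sees-partner : ∀ {e w w′ x} → e ∈ₑ K → Joins e w w′ → x ∈ covered K → ¬ Adj w x → Adj x w′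
      sees-partner e∈K j x∈ ¬wx with covered⁻ K x∈
      ... | f , f∈K , x′ , jx with same-or-shared e∈K f∈K
      ...   | inj₁ refl = [ (λ { refl → joins-adj j }) , (λ { refl → ⊥-elim (¬wx (joins-adj j)) }) ]
                            (joins-endpoint j jx)
      ...   | inj₂ (B , cb , e∈B , f∈B) =
        adj-sym (coP₃-free cb _ _ _ (proj₁ (joins-∈ j e∈B)) (proj₂ (joins-∈ j e∈B)) (proj₁ (joins-∈ jx f∈B))
                  (joins-adj j) ¬wx)

      covered-coP₃-free : CoP₃Free (covered K)
      covered-coP₃-free u v w u∈ v∈ w∈ uv ¬uw with adj? v w
      ... | yes vw = vw
      ... | no ¬vw with covered⁻ K w∈
      ...   | e , e∈K , w′ , j = ⊥-elim (covered-triangle-free u v w′ u∈ v∈ (covered⁺ K e∈K (joins-sym j)) uv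
                                   (sees-partner e∈K j v∈ (¬vw ∘ adj-sym))
                                   (sees-partner e∈K j u∈ (¬uw ∘ adj-sym)))

    covered-completeBipartite : (∃ λ e → e ∈ₑ K) → CompleteBipartite (covered K)
    covered-completeBipartite (e , e∈K) =
      complete-bipartite (∈E⇒spansEdge e (∈E-covered K e e∈K)) covered-triangle-free covered-coP₃-free

  EBHyperedge⇒clique : ¬ HasInducedPrism G → ∀ {F} → IsEBHyperedge G F → IsCliqueOfL G F
  EBHyperedge⇒clique prism-free {F} (B , bic , F≐B) = nonempty , complete , maximal
    where
    cbB : CompleteBipartite B
    cbB = biclique⇒completeBipartite bic

    edge-at : ∀ {v} → v ∈ B → Σ (Edge G) λ e → e ∈ₑ F × ∃ (Joins e v)
    edge-at v∈B with completeBipartite-no-isolated cbB v∈B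
    ... | u , u∈B , vu with edge-joining vu
    ...   | e , j = e , Equivalence.from (F≐B e) (joins-∈E j v∈B u∈B) , u , j

    nonempty : ∃ λ e → e ∈ₑ F
    nonempty with spans-edge cbB
    ... | x , _ , x∈B , _ with edge-at x∈B
    ...   | e , e∈F , _ = e , e∈F

    complete : IsCompleteInL G F
    complete e f e∈F f∈F _ = B , bic , Equivalence.to (F≐B e) e∈F , Equivalence.to (F≐B f) f∈F

    -- F ∪ {e} is complete, so the vertices it covers form a complete bipartite
    -- superset of B, which equals B by maximality.
    maximal : ∀ e → (∀ f → f ∈ₑ F → e ≢ f → LAdjacent G e f) → e ∈ₑ F
    maximal e e∼F = Equivalence.from (F≐B e) (∈E-mono covered⊆B e (∈E-covered F∪e e e∈F∪e))
      where
      F∪e : ESet G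
      F∪e = F E.∪ E.⁅ e ⁆
      e∈F∪e : e ∈ₑ F∪e
      e∈F∪e = E.∈-∪ʳ F E.⁅ e ⁆ {e} (E.x∈⁅x⁆ e)
      B⊆covered : B ⊆ covered F∪e
      B⊆covered v v∈B with edge-at v∈B
      ... | f , f∈F , _ , j = covered⁺ F∪e (E.∈-∪ˡ F E.⁅ e ⁆ {f} f∈F) j
      cF∪e : CompleteBipartite (covered F∪e)
      cF∪e = covered-completeBipartite prism-free (complete-∪⁅⁆ complete e∼F) (e , e∈F∪e)
      covered⊆B : covered F∪e ⊆ B
      covered⊆B = proj₂ bic (covered F∪e) (completeBipartite⇒induces cF∪e) B⊆covered

  clique⇒EBHyperedge : ¬ HasInducedPrism G → ∀ {F} → IsCliqueOfL G F → IsEBHyperedge G F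
  clique⇒EBHyperedge prism-free {F} (nonempty , complete , maximal) =
    hyperedge (extend-to-biclique (covered-completeBipartite prism-free complete nonempty))
    where
    hyperedge : (Σ (VSet n) λ B → IsBiclique G B × covered F ⊆ B) → IsEBHyperedge G F
    hyperedge (B , bic , covered⊆B) = B , bic , λ e → mk⇔ (in-B e) (in-F e)
      where
      in-B : ∀ e → e ∈ₑ F → e ∈E[ B ]
      in-B e e∈F = ∈E-mono covered⊆B e (∈E-covered F e e∈F)
      in-F : ∀ e → e ∈E[ B ] → e ∈ₑ F
      in-F e e∈B = maximal e λ f f∈F _ → B , bic , e∈B , in-B f f∈F

  triangle-complete : ∀ {e₁ e₂ e₃} → LAdjacent G e₁ e₂ → LAdjacent G e₂ e₃ → LAdjacent G e₁ e₃ →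
                      IsCompleteInL G ((E.⁅ e₁ ⁆ E.∪ E.⁅ e₂ ⁆) E.∪ E.⁅ e₃ ⁆)
  triangle-complete {e₁} {e₂} {e₃} L₁₂ L₂₃ L₁₃ = complete-∪⁅⁆ (complete-∪⁅⁆ (⁅⁆-complete e₁) e₂∼) e₃∼
    where
    e₂∼ : ∀ f → f ∈ₑ E.⁅ e₁ ⁆ → e₂ ≢ f → LAdjacent G e₂ f
    e₂∼ f f∈ _ with E.∈⁅⁆⁻ {e₁} {f} f∈
    ... | refl = LAdjacent-sym {e₁} {e₂} L₁₂
    e₃∼ : ∀ f → f ∈ₑ (E.⁅ e₁ ⁆ E.∪ E.⁅ e₂ ⁆) → e₃ ≢ f → LAdjacent G e₃ f
    e₃∼ f f∈ _ with E.∈-⁅⁆∪⁅⁆⁻ e₁ e₂ f f∈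
    ... | inj₁ refl = LAdjacent-sym {e₁} {e₃} L₁₃
    ... | inj₂ refl = LAdjacent-sym {e₂} {e₃} L₂₃

  -- The clique of L_G containing the three edges is, by assumption, the edge set of a biclique.
  EBEqualsKL⇒common-biclique : EBEqualsKL G → ∀ e₁ e₂ e₃ →
    LAdjacent G e₁ e₂ → LAdjacent G e₂ e₃ → LAdjacent G e₁ e₃ →
    Σ (VSet n) λ B → IsBiclique G B × e₁ ∈E[ B ] × e₂ ∈E[ B ] × e₃ ∈E[ B ]
  EBEqualsKL⇒common-biclique EB=KL e₁ e₂ e₃ L₁₂ L₂₃ L₁₃ =
    common (extend-to-clique (triangle-complete L₁₂ L₂₃ L₁₃) (e₁ , e₁∈K))
    where
    K₁₂ K : ESet G
    K₁₂ = E.⁅ e₁ ⁆ E.∪ E.⁅ e₂ ⁆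
    K = K₁₂ E.∪ E.⁅ e₃ ⁆
    e₁∈K : e₁ ∈ₑ K
    e₁∈K = E.∈-∪ˡ K₁₂ E.⁅ e₃ ⁆ {e₁} (E.∈-∪ˡ E.⁅ e₁ ⁆ E.⁅ e₂ ⁆ {e₁} (E.x∈⁅x⁆ e₁))
    e₂∈K : e₂ ∈ₑ K
    e₂∈K = E.∈-∪ˡ K₁₂ E.⁅ e₃ ⁆ {e₂} (E.∈-∪ʳ E.⁅ e₁ ⁆ E.⁅ e₂ ⁆ {e₂} (E.x∈⁅x⁆ e₂))
    e₃∈K : e₃ ∈ₑ K
    e₃∈K = E.∈-∪ʳ K₁₂ E.⁅ e₃ ⁆ {e₃} (E.x∈⁅x⁆ e₃)
    common : (Σ (ESet G) λ C → IsCliqueOfL G C × K E.⊆ C) →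
             Σ (VSet n) λ B → IsBiclique G B × e₁ ∈E[ B ] × e₂ ∈E[ B ] × e₃ ∈E[ B ]
    common (C , clique , K⊆C) with Equivalence.from (EB=KL C) clique
    ... | B , bic , C≐B = B , bic , in-B e₁ e₁∈K , in-B e₂ e₂∈K , in-B e₃ e₃∈K
      where
      in-B : ∀ e → e ∈ₑ K → e ∈E[ B ]
      in-B e e∈K = Equivalence.to (C≐B e) (K⊆C e e∈K)

  -- ad, be, cf are pairwise L-adjacent through the 4-cycles adeb, befc, adfc.
  prism⇒¬EBEqualsKL : Prism → ¬ EBEqualsKL G
  prism⇒¬EBEqualsKL (prism a b c d e f ab ac bc de df ef ad be cf ¬ae ¬af ¬bd ¬bf ¬cd ¬ce) EB=KL =
    no-common-biclique (EBEqualsKL⇒common-biclique EB=KL E₁ E₂ E₃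
      (C4-LAdjacent ad de (adj-sym be) (adj-sym ab) ¬ae (¬bd ∘ adj-sym) j₁ (joins-sym j₂))
      (C4-LAdjacent be ef (adj-sym cf) (adj-sym bc) ¬bf (¬ce ∘ adj-sym) j₂ (joins-sym j₃))
      (C4-LAdjacent ad df (adj-sym cf) (adj-sym ac) ¬af (¬cd ∘ adj-sym) j₁ (joins-sym j₃)))
    where
    E₁ E₂ E₃ : Edge G
    E₁ = proj₁ (edge-joining ad)
    E₂ = proj₁ (edge-joining be)
    E₃ = proj₁ (edge-joining cf)
    j₁ : Joins E₁ a d
    j₁ = proj₂ (edge-joining ad)
    j₂ : Joins E₂ b e
    j₂ = proj₂ (edge-joining be)
    j₃ : Joins E₃ c f
    j₃ = proj₂ (edge-joining cf)
    no-common-biclique : ¬ (Σ (VSet n) λ B → IsBiclique G B × E₁ ∈E[ B ] × E₂ ∈E[ B ] × E₃ ∈E[ B ])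
    no-common-biclique (B , bic , E₁∈B , E₂∈B , E₃∈B) =
      triangle-free (biclique⇒completeBipartite bic) a b c
        (proj₁ (joins-∈ {S = B} j₁ E₁∈B)) (proj₁ (joins-∈ {S = B} j₂ E₂∈B))
        (proj₁ (joins-∈ {S = B} j₃ E₃∈B)) ab bc ac

theorem5 : ∀ (n : ℕ) (G : Graph n) → EBEqualsKL G ⇔ (¬ HasInducedPrism G)
theorem5 n G = mk⇔
  (λ EB=KL has-prism → prism⇒¬EBEqualsKL G (hasInducedPrism⇒Prism G has-prism) EB=KL)
  (λ prism-free F → mk⇔ (EBHyperedge⇒clique G prism-free) (clique⇒EBHyperedge G prism-free))
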